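{- Let $G=B(d(0),d(1),\dots,d(n-1))$ be a generalized Bethe tree with levels $C_0,\dots,C_n$, $d(n)=0$, and let $g_0,\dots,g_n$ be the polynomials $g_0(\lambda)=1$, $g_1(\lambda)=\lambda$, $g_j(\lambda)=(d(n-j+1)+1)\lambda g_{j-1}(\lambda)-d(n-j+1)g_{j-2}(\lambda)$ for $j\in[2,n]$. Let $\Omega=\{i\in[1,n] : d(n-i)\ge2\}$. Let $i\in\Omega$, let $\lambda$ be a root of $g_i$, let $v^*\in C_{n-i}$, and let $v_1,v_2$ be two distinct children of $v^*$. Define $f\in\mathbb{C}^{V}$ by: $f(P^j(w))=g_j(\lambda)$ for $w\in N_n(v_1)$ and $j\in[0,i-1]$; $f(P^j(w))=-g_j(\lambda)$ for $w\in N_n(v_2)$ and $j\in[0,i-1]$; $f(P^j(w))=0$ for $w\in C_n\setminus(N_n(v_1)\cup N_n(v_2))$ and $j\in[0,i-1]$; and $f(w)=0$ for $w\in\bigcup_{j=0}^{n-i}C_j$. Then $f$ is a nonzero vector in $\mathcal{A}^{\perp}$ satisfying $Tf=\lambda f$. In particular, every root of $g_i$, $i\in\Omega$, is an eigenvalue of $T$ with an eigenvector in $\mathcal{A}^\perp$.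
   Context: A generalized Bethe tree $B(d(0),\dots,d(n-1))$ ($n\ge1$, all $d(i)\ge1$) is a rooted tree with levels $C_0=\{\text{root}\},\dots,C_n$ in which each vertex of $C_i$ ($0\le i\le n-1$) has exactly $d(i)$ children in $C_{i+1}$, each non-root vertex has exactly one neighbour (its parent) in the previous level, and vertices of $C_n$ are leaves. $T$ is the transition matrix of the simple random walk: $T_{u,v}=1/\deg(u)$ if $u\sim v$, else $0$. $P$ maps a non-root vertex to its parent, $P^0(v)=v$, $P^j$ is the $j$-fold iterate. $N_n(v)=\{w\in C_n : P^j(w)=v \text{ for some } j\}$ is the set of descendants of $v$ in $C_n$. $\mathcal{A}^\perp=\{f\in\mathbb{C}^V : \sum_{v\in C_m}f(v)=0 \ \forall m\in[0,n]\}$. $[i,j]=\{i,\dots,j\}$. -}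

module Defs where

open import Level using (Level; _⊔_) renaming (suc to lsuc)
open import Data.Nat using (ℕ; zero; suc; _∸_; _≤_; _<_; s≤s; z≤n; _<?_)
open import Data.Nat.Properties using (≤-trans; n≤1+n; m∸n≤m)
open import Data.Fin using (Fin)
open import Data.List using (List; []; _∷_; _++_; map; concatMap; length; allFin; foldr)
open import Data.Product using (Σ; _×_; _,_; ∃)
open import Data.Unit using (⊤; tt)
open import Relation.Nullary using (¬_; yes; no)
open import Relation.Binary.PropositionalEquality using (_≡_)
open import Algebra.Bundles using (CommutativeRing)

record Field (c ℓ : Level) : Set (lsuc (c ⊔ ℓ)) where
  field
    commutativeRing : CommutativeRing c ℓ
  open CommutativeRing commutativeRing public
  field
    _⁻¹       : Carrier → Carrier
    ⁻¹-inverse : ∀ x → ¬ (x ≈ 0#) → (x * (x ⁻¹)) ≈ 1#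
    0≉1       : ¬ (0# ≈ 1#)

module _ {c ℓ : Level} (F : Field c ℓ) where
  open Field F

  ι : ℕ → Carrier
  ι zero    = 0#
  ι (suc m) = 1# + ι m

  CharZero : Set ℓ
  CharZero = ∀ m → ¬ (ι (suc m) ≈ 0#)

  Σ-list : List Carrier → Carrier
  Σ-list = foldr _+_ 0#

-- A vertex of level m (0 ≤ m ≤ n) is given by its address: the sequence
-- of child indices (c₀,...,c_{m-1}) with cₖ ∈ Fin (d k) on the path from
-- the root.  Level m vertex (a , c) is the c-th child of the level
-- (m-1) vertex a.

Addr : (d : ℕ → ℕ) → ℕ → Set
Addr d zero    = ⊤
Addr d (suc m) = Addr d m × Fin (d m)

addrs : (d : ℕ → ℕ) → (m : ℕ) → List (Addr d m)
addrs d zero    = tt ∷ []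
addrs d (suc m) = concatMap (λ a → map (λ c → (a , c)) (allFin (d m))) (addrs d m)

record Vertex (n : ℕ) (d : ℕ → ℕ) : Set where
  constructor vtx
  field
    level : ℕ
    bound : level ≤ n
    addr  : Addr d level
open Vertex public

-- the parent map P (the root is sent to itself; P is only ever applied
-- to non-root vertices in the statement)
P : ∀ {n d} → Vertex n d → Vertex n d
P (vtx zero    p a)       = vtx zero p a
P (vtx (suc m) p (a , c)) = vtx m (≤-trans (n≤1+n m) p) a

P^ : ∀ {n d} → ℕ → Vertex n d → Vertex n d
P^ zero    v = v
P^ (suc j) v = P (P^ j v)

IsLeaf : ∀ {n d} → Vertex n d → Set
IsLeaf {n} v = level v ≡ n

InN : ∀ {n d} → Vertex n d → Vertex n d → Set
InN w v = IsLeaf w × ∃ (λ j → P^ j w ≡ v)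

parents : ∀ {n d} → Vertex n d → List (Vertex n d)
parents (vtx zero    p a) = []
parents (vtx (suc m) p a) = P (vtx (suc m) p a) ∷ []

children : ∀ {n d} → Vertex n d → List (Vertex n d)
children {n} {d} (vtx m p a) with m <? n
... | yes m<n = map (λ c → vtx (suc m) m<n (a , c)) (allFin (d m))
... | no  _   = []

neighbours : ∀ {n d} → Vertex n d → List (Vertex n d)
neighbours v = parents v ++ children v

deg : ∀ {n d} → Vertex n d → ℕ
deg v = length (neighbours v)

module _ {c ℓ : Level} (F : Field c ℓ) where
  open Field F

  T : ∀ {n d} → (Vertex n d → Carrier) → Vertex n d → Carrier
  T f u = (ι F (deg u) ⁻¹) * Σ-list F (map f (neighbours u))

  InAperp : ∀ {n d} → (Vertex n d → Carrier) → Set ℓ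
  InAperp {n} {d} f =
    ∀ m (p : m ≤ n) → Σ-list F (map (λ a → f (vtx m p a)) (addrs d m)) ≈ 0#

  -- the polynomials g_j evaluated at λ :
  -- g₀ = 1, g₁ = λ,
  -- g_j = (d(n-j+1)+1) λ g_{j-1} - d(n-j+1) g_{j-2}  (j ≥ 2);
  -- for j = k+2 we have n-j+1 = n ∸ (k+1).
  g : (n : ℕ) (d : ℕ → ℕ) → ℕ → Carrier → Carrier
  g n d zero          x = 1#
  g n d (suc zero)    x = x
  g n d (suc (suc k)) x =
    ((ι F (d (n ∸ suc k)) + 1#) * x * g n d (suc k) x)
      - (ι F (d (n ∸ suc k)) * g n d k x)

n∸i<n : ∀ {n i} → 1 ≤ n → 1 ≤ i → n ∸ i < n
n∸i<n {suc n} {suc i} _ _ = s≤s (m∸n≤m n i)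

child : ∀ {n d} (v : Vertex n d) → level v < n → Fin (d (level v)) → Vertex n d
child (vtx m p a) m<n c = vtx (suc m) m<n (a , c)

atLevel∸ : ∀ {n d} (i : ℕ) → Addr d (n ∸ i) → Vertex n d
atLevel∸ {n} i a = vtx (n ∸ i) (m∸n≤m n i) a

module Submission where

-- The eigenvector is φ u = s(u) · g_{n-ℓ(u)}(λ), where ℓ(u) is the level of u and s(u) is 1, -1 or 0
-- according as u lies below v₁, below v₂ or neither. Strictly below the level of v* the eigen-equation
-- at u is the three-term recurrence of the g_j (at a leaf it reads g₁ = λ g₀, since d n = 0); at the
-- children of v* the parent term is harmless because g_i(λ) = 0. At the level of v* and above, φ
-- vanishes and so does the sum of s over the children of each vertex, while below v* the children of u
-- all carry s(u); summing s level by level therefore also puts φ in 𝒜^⊥. Conversely, the defining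
-- clauses fix f on every path from a leaf up to the children of v*, so f = φ.

open import Defs
open import Level using (Level)
open import Algebra.Bundles using (CommutativeRing)
open import Data.Bool using (if_then_else_)
open import Data.Nat using (ℕ; zero; suc; pred; _∸_; _≤_; _<_; s≤s; z≤n; _≟_; _<?_; _≤?_)
  renaming (_+_ to _+ℕ_)
open import Data.Nat.Properties
  using (≤-irrelevant; ≤-refl; ≤-trans; n≮n; <⇒≤; <⇒≢; ≰⇒>; m≤n⇒m<n∨m≡n; n≤1+n; m≤n+m;
         +-suc; pred[n]≤n; pred[m∸n]≡m∸[1+n]; +-∸-assoc; m∸[m∸n]≡n; m∸n+n≡m; n∸n≡0;
         m≤n⇒m∸n≡0; ∸-monoʳ-<)
open import Data.Fin using (Fin; zero; suc; fromℕ<) renaming (_≟_ to _≟ᶠ_)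
open import Data.List using (List; []; _∷_; _++_; map; length; allFin; tabulate; concatMap; foldr)
open import Data.List.Properties
  using (map-++; map-∘; map-cong; map-tabulate; tabulate-cong; length-map; length-tabulate)
open import Data.Maybe using (Maybe; just; nothing)
open import Data.Maybe.Properties using (just-injective)
open import Data.Product using (Σ; _×_; _,_; ∃)
open import Data.Product.Properties using (≡-dec)
open import Data.Sum using (_⊎_; inj₁; inj₂)
open import Data.Unit using (tt)
open import Function using (id; _∘_; case_of_)
open import Relation.Nullary using (¬_; Dec; yes; no; does; contradiction)
open import Relation.Nullary.Decidable using (dec-true; dec-false)
open import Relation.Binary.Definitions using (DecidableEquality)
open import Relation.Binary.PropositionalEquality as ≡ using (_≡_; _≢_)

module Sums {c ℓ : Level} (R : CommutativeRing c ℓ) where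
  open CommutativeRing R hiding (zero)
  open import Algebra.Properties.CommutativeSemigroup +-commutativeSemigroup using (interchange)
  open import Algebra.Properties.AbelianGroup +-abelianGroup using (⁻¹-∙-comm)
  open import Relation.Binary.Reasoning.Setoid setoid

  sum : List Carrier → Carrier
  sum = foldr _+_ 0#

  sum-++ : ∀ xs ys → sum (xs ++ ys) ≈ sum xs + sum ys
  sum-++ []       ys = sym (+-identityˡ (sum ys))
  sum-++ (x ∷ xs) ys = trans (+-congˡ (sum-++ xs ys)) (sym (+-assoc x (sum xs) (sum ys)))

  module _ {A : Set} where

    sum-map-cong : {f h : A → Carrier} → (∀ a → f a ≈ h a) → ∀ L → sum (map f L) ≈ sum (map h L)
    sum-map-cong f≈h []      = refl
    sum-map-cong f≈h (a ∷ L) = +-cong (f≈h a) (sum-map-cong f≈h L)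

    sum-map-zero : {f : A → Carrier} → (∀ a → f a ≈ 0#) → ∀ L → sum (map f L) ≈ 0#
    sum-map-zero f≈0 []      = refl
    sum-map-zero f≈0 (a ∷ L) = trans (+-cong (f≈0 a) (sum-map-zero f≈0 L)) (+-identityˡ 0#)

    sum-map-*ˡ : ∀ y (f : A → Carrier) L → sum (map (λ a → y * f a) L) ≈ y * sum (map f L)
    sum-map-*ˡ y f []      = sym (zeroʳ y)
    sum-map-*ˡ y f (a ∷ L) = trans (+-congˡ (sum-map-*ˡ y f L)) (sym (distribˡ y (f a) _))

    sum-map-*ʳ : ∀ (f : A → Carrier) y L → sum (map (λ a → f a * y) L) ≈ sum (map f L) * y
    sum-map-*ʳ f y []      = sym (zeroˡ y)
    sum-map-*ʳ f y (a ∷ L) = trans (+-congˡ (sum-map-*ʳ f y L)) (sym (distribʳ y (f a) _))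

    sum-map-− : ∀ (f h : A → Carrier) L →
                sum (map (λ a → f a - h a) L) ≈ sum (map f L) - sum (map h L)
    sum-map-− f h []      = sym (-‿inverseʳ 0#)
    sum-map-− f h (a ∷ L) = begin
      (f a - h a) + sum (map (λ a → f a - h a) L)      ≈⟨ +-congˡ (sum-map-− f h L) ⟩
      (f a - h a) + (sum (map f L) - sum (map h L))    ≈⟨ interchange (f a) (- h a) _ _ ⟩
      (f a + sum (map f L)) + (- h a - sum (map h L))  ≈⟨ +-congˡ (⁻¹-∙-comm (h a) _) ⟩
      (f a + sum (map f L)) - (h a + sum (map h L))    ∎

  sum-map-concatMap : ∀ {A B : Set} (f : B → Carrier) (h : A → List B) L →
    sum (map f (concatMap h L)) ≈ sum (map (λ a → sum (map f (h a))) L)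
  sum-map-concatMap f h []      = refl
  sum-map-concatMap f h (a ∷ L) = begin
    sum (map f (h a ++ concatMap h L))                         ≡⟨ ≡.cong sum (map-++ f (h a) _) ⟩
    sum (map f (h a) ++ map f (concatMap h L))                 ≈⟨ sum-++ (map f (h a)) _ ⟩
    sum (map f (h a)) + sum (map f (concatMap h L))            ≈⟨ +-congˡ (sum-map-concatMap f h L) ⟩
    sum (map f (h a)) + sum (map (λ a → sum (map f (h a))) L)  ∎

  δ : ∀ {k} → Fin k → Fin k → Carrier
  δ c′ c = if does (c ≟ᶠ c′) then 1# else 0#

  δ-refl : ∀ {k} (c : Fin k) → δ c c ≡ 1#
  δ-refl c = ≡.cong (if_then 1# else 0#) (dec-true (c ≟ᶠ c) ≡.refl)

  δ-≢ : ∀ {k} {c′ c : Fin k} → c ≢ c′ → δ c′ c ≡ 0#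
  δ-≢ {c′ = c′} {c} c≢c′ = ≡.cong (if_then 1# else 0#) (dec-false (c ≟ᶠ c′) c≢c′)

  sum-tabulate-δ : ∀ {k} (c′ : Fin k) → sum (tabulate (δ c′)) ≈ 1#
  sum-tabulate-δ {suc k} c′@zero = begin
    1# + sum (tabulate (λ c → δ c′ (suc c)))        ≡⟨ ≡.cong (λ L → 1# + sum L) (map-tabulate {n = k} id _) ⟨
    1# + sum (map (λ c → δ c′ (suc c)) (allFin k))  ≈⟨ +-congˡ (sum-map-zero (λ _ → refl) (allFin k)) ⟩
    1# + 0#                                         ≈⟨ +-identityʳ 1# ⟩
    1#                                              ∎
  sum-tabulate-δ {suc k} c″@(suc c′) = begin
    0# + sum (tabulate (λ c → δ c″ (suc c)))  ≈⟨ +-identityˡ _ ⟩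
    sum (tabulate (λ c → δ c″ (suc c)))       ≡⟨ ≡.cong sum (tabulate-cong {n = k} (λ _ → ≡.refl)) ⟩
    sum (tabulate (δ c′))                     ≈⟨ sum-tabulate-δ c′ ⟩
    1#                                        ∎

  sum-δ : ∀ {k} (c′ : Fin k) → sum (map (δ c′) (allFin k)) ≈ 1#
  sum-δ c′ = trans (reflexive (≡.cong sum (map-tabulate id (δ c′)))) (sum-tabulate-δ c′)

module _ {c ℓ : Level} (R : CommutativeRing c ℓ) where
  open CommutativeRing R
  open import Algebra.Properties.Group +-group using (//-rightDividesˡ)
  open import Algebra.Solver.Ring.NaturalCoefficients commutativeSemiring (λ _ _ → nothing)
  open import Relation.Binary.Reasoning.Setoid setoid

  recurrence⇒local-eigen-equation : ∀ D y w a b e → e ≈ (D + 1#) * y * a - D * b →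
                                    w * e + D * (w * b) ≈ (1# + D) * (y * (w * a))
  recurrence⇒local-eigen-equation D y w a b e e≈ = begin
    w * e + D * (w * b)
      ≈⟨ solve 4 (λ w e D b → w :* e :+ D :* (w :* b) := w :* (e :+ D :* b)) refl w e D b ⟩
    w * (e + D * b)
      ≈⟨ *-congˡ (trans (+-congʳ e≈) (//-rightDividesˡ (D * b) _)) ⟩
    w * ((D + 1#) * y * a)
      ≈⟨ solve 4 (λ D y w a → w :* ((D :+ con 1) :* y :* a) := (con 1 :+ D) :* (y :* (w :* a))) refl D y w a ⟩
    (1# + D) * (y * (w * a)) ∎

module FieldFacts {c ℓ : Level} (F : Field c ℓ) where
  open Field F hiding (zero)
  open Sums commutativeRing
  open import Relation.Binary.Reasoning.Setoid setoid

  sum-replicate : ∀ {A : Set} y (L : List A) → sum (map (λ _ → y) L) ≈ ι F (length L) * y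
  sum-replicate y []      = sym (zeroˡ y)
  sum-replicate y (_ ∷ L) = trans (+-cong (sym (*-identityˡ y)) (sum-replicate y L)) (sym (distribʳ y 1# _))

  ι-nonzero : CharZero F → ∀ {m} → 0 < m → ¬ ι F m ≈ 0#
  ι-nonzero charZero {suc m} _ = charZero m

  module _ {n : ℕ} {d : ℕ → ℕ} where

    T-cong : ∀ {f h : Vertex n d → Carrier} → (∀ v → f v ≈ h v) → ∀ u → T F f u ≈ T F h u
    T-cong f≈h u = *-congˡ (sum-map-cong f≈h (neighbours u))

    InAperp-cong : ∀ {f h : Vertex n d → Carrier} → (∀ v → f v ≈ h v) → InAperp F h → InAperp F f
    InAperp-cong f≈h h⊥ m p = trans (sum-map-cong (λ a → f≈h (vtx m p a)) (addrs d m)) (h⊥ m p)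

    T-eigen : ∀ (f : Vertex n d → Carrier) y u → ¬ ι F (deg u) ≈ 0# →
              sum (map f (neighbours u)) ≈ ι F (deg u) * (y * f u) → T F f u ≈ y * f u
    T-eigen f y u deg≉0 sum≈ = begin
      ι F (deg u) ⁻¹ * sum (map f (neighbours u))  ≈⟨ *-congˡ sum≈ ⟩
      ι F (deg u) ⁻¹ * (ι F (deg u) * (y * f u))   ≈⟨ *-assoc _ _ _ ⟨
      ι F (deg u) ⁻¹ * ι F (deg u) * (y * f u)     ≈⟨ *-congʳ (trans (*-comm _ _) (⁻¹-inverse _ deg≉0)) ⟩
      1# * (y * f u)                               ≈⟨ *-identityˡ _ ⟩
      y * f u                                      ∎

n∸m≡suc[n∸suc[m]] : ∀ {m n} → m < n → n ∸ m ≡ suc (n ∸ suc m)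
n∸m≡suc[n∸suc[m]] = +-∸-assoc 1

_≟ᴬ_ : ∀ {d m} → DecidableEquality (Addr d m)
_≟ᴬ_ {m = zero}  tt tt = yes ≡.refl
_≟ᴬ_ {m = suc m}       = ≡-dec _≟ᴬ_ _≟ᶠ_

module BetheTree {n : ℕ} {d : ℕ → ℕ} where

  vtx-cong : ∀ {m} {p q : m ≤ n} {a b : Addr d m} → a ≡ b → _≡_ {A = Vertex n d} (vtx m p a) (vtx m q b)
  vtx-cong {p = p} {q} ≡.refl = ≡.cong (λ r → vtx _ r _) (≤-irrelevant p q)

  level-P : ∀ (u : Vertex n d) → level (P u) ≡ pred (level u)
  level-P (vtx zero    _ _) = ≡.refl
  level-P (vtx (suc m) _ _) = ≡.refl

  level-P^ : ∀ j (u : Vertex n d) → level (P^ j u) ≡ level u ∸ j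
  level-P^ zero    u = ≡.refl
  level-P^ (suc j) u = ≡.trans (level-P (P^ j u))
    (≡.trans (≡.cong pred (level-P^ j u)) (pred[m∸n]≡m∸[1+n] (level u) j))

  P^-+ : ∀ j k (u : Vertex n d) → P^ (j +ℕ k) u ≡ P^ j (P^ k u)
  P^-+ zero    k u = ≡.refl
  P^-+ (suc j) k u = ≡.cong P (P^-+ j k u)

  children-< : ∀ (u : Vertex n d) (q : level u < n) →
               children u ≡ map (λ c → vtx (suc (level u)) q (addr u , c)) (allFin (d (level u)))
  children-< (vtx m p a) q with m <? n
  ... | yes q′ = ≡.cong (λ r → map (λ c → vtx (suc m) r (a , c)) (allFin (d m))) (≤-irrelevant q′ q)
  ... | no ¬q  = contradiction q ¬q

  children-leaf : ∀ (u : Vertex n d) → IsLeaf u → children u ≡ []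
  children-leaf (vtx m p a) leaf with m <? n
  ... | yes q = contradiction (≡.subst (_< n) leaf q) (n≮n n)
  ... | no _  = ≡.refl

  length-children : d n ≡ 0 → ∀ (u : Vertex n d) → length (children u) ≡ d (level u)
  length-children dn u with m≤n⇒m<n∨m≡n (bound u)
  ... | inj₁ q = ≡.trans (≡.cong length (children-< u q))
                   (≡.trans (length-map _ (allFin (d (level u)))) (length-tabulate id))
  ... | inj₂ leaf = ≡.trans (≡.cong length (children-leaf u leaf)) (≡.sym (≡.trans (≡.cong d leaf) dn))

  leaf-descendant : (∀ k → k < n → 0 < d k) →
                    ∀ k (u : Vertex n d) → k +ℕ level u ≡ n → ∃ λ w → IsLeaf w × P^ k w ≡ u
  leaf-descendant d>0 zero    u e = u , e , ≡.refl
  leaf-descendant d>0 (suc k) u e =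
    let m<n = ≡.subst (level u <_) e (s≤s (m≤n+m (level u) k))
        w , leaf , Pᵏw≡ = leaf-descendant d>0 k
          (vtx (suc (level u)) m<n (addr u , fromℕ< (d>0 (level u) m<n))) (≡.trans (+-suc k (level u)) e)
    in w , leaf , ≡.trans (≡.cong P Pᵏw≡) (vtx-cong ≡.refl)

module Branch {n : ℕ} {d : ℕ → ℕ} (K : ℕ) (K<n : K < n) (a* : Addr d K) where
  open BetheTree {n} {d}

  -- The child of v* (the vertex of level K with address a*) whose subtree contains the vertex, if any.
  branch : ∀ m → Addr d m → Maybe (Fin (d K))
  branch zero    _       = nothing
  branch (suc m) (a , c) with m ≟ K
  ... | no _ = branch m a
  ... | yes ≡.refl with a ≟ᴬ a*
  ...   | yes _ = just c
  ...   | no  _ = nothing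

  branchᵛ : Vertex n d → Maybe (Fin (d K))
  branchᵛ u = branch (level u) (addr u)

  v*-child : Fin (d K) → Vertex n d
  v*-child c = vtx (suc K) K<n (a* , c)

  branch-≤ : ∀ m a → m ≤ K → branch m a ≡ nothing
  branch-≤ zero    _       _ = ≡.refl
  branch-≤ (suc m) (a , c) m<K with m ≟ K
  ... | yes ≡.refl = contradiction m<K (n≮n m)
  ... | no _       = branch-≤ m a (<⇒≤ m<K)

  branch-suc : ∀ {m} a c → m ≢ K → branch (suc m) (a , c) ≡ branch m a
  branch-suc {m} a c m≢K with m ≟ K
  ... | yes m≡K = contradiction m≡K m≢K
  ... | no _    = ≡.refl

  branch-v*-child : ∀ c → branchᵛ (v*-child c) ≡ just c
  branch-v*-child c with K ≟ K
  ... | no K≢K = contradiction ≡.refl K≢K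
  ... | yes ≡.refl with a* ≟ᴬ a*
  ...   | yes _  = ≡.refl
  ...   | no a*≢ = contradiction ≡.refl a*≢

  branch-off-v* : ∀ {a} c → a ≢ a* → branch (suc K) (a , c) ≡ nothing
  branch-off-v* {a} c a≢a* with K ≟ K
  ... | no K≢K = contradiction ≡.refl K≢K
  ... | yes ≡.refl with a ≟ᴬ a*
  ...   | yes a≡a* = contradiction a≡a* a≢a*
  ...   | no _     = ≡.refl

  branch-P : ∀ (u : Vertex n d) → K < level (P u) → branchᵛ (P u) ≡ branchᵛ u
  branch-P (vtx zero    _ _)       _   = ≡.refl
  branch-P (vtx (suc m) _ (a , c)) K<m = ≡.sym (branch-suc a c (λ m≡K → <⇒≢ K<m (≡.sym m≡K)))

  branch-P^ : ∀ j (u : Vertex n d) → K < level (P^ j u) → branchᵛ (P^ j u) ≡ branchᵛ u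
  branch-P^ zero    u _   = ≡.refl
  branch-P^ (suc j) u K<ℓ = ≡.trans (branch-P (P^ j u) K<ℓ)
    (branch-P^ j u (≤-trans K<ℓ (≡.subst (_≤ level (P^ j u)) (≡.sym (level-P (P^ j u))) pred[n]≤n)))

  descends-from-v*-child : ∀ m (p : m ≤ n) a {c} → branch m a ≡ just c →
                           ∃ λ j → P^ j (vtx m p a) ≡ v*-child c
  descends-from-v*-child zero    _ _        ()
  descends-from-v*-child (suc m) p (a , c′) e with m ≟ K
  ... | no _ = let j , Pʲ≡ = descends-from-v*-child m (≤-trans (n≤1+n m) p) a e
               in j +ℕ 1 , ≡.trans (P^-+ j 1 _) Pʲ≡
  ... | yes ≡.refl with a ≟ᴬ a*
  ...   | yes ≡.refl = 0 , vtx-cong (≡.cong (a* ,_) (just-injective e))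
  ...   | no _       = contradiction e λ ()

  InN⇒branch : ∀ {w c} → InN w (v*-child c) → branchᵛ w ≡ just c
  InN⇒branch {w} {c} (_ , j , Pʲw≡) = begin
    branchᵛ w             ≡⟨ branch-P^ j w (≡.subst (K <_) (≡.sym (≡.cong level Pʲw≡)) ≤-refl) ⟨
    branchᵛ (P^ j w)      ≡⟨ ≡.cong branchᵛ Pʲw≡ ⟩
    branchᵛ (v*-child c)  ≡⟨ branch-v*-child c ⟩
    just c                ∎
    where open ≡.≡-Reasoning

  branch⇒InN : ∀ {w c} → IsLeaf w → branchᵛ w ≡ just c → InN w (v*-child c)
  branch⇒InN {w} leaf e = leaf , descends-from-v*-child (level w) (bound w) (addr w) e

module Eigenvector
  {c ℓ : Level} (F : Field c ℓ) (charZero : CharZero F)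
  {n : ℕ} {d : ℕ → ℕ} (1≤n : 1 ≤ n) (d>0 : ∀ k → k < n → 1 ≤ d k) (dn≡0 : d n ≡ 0)
  {i : ℕ} (1≤i : 1 ≤ i) (i≤n : i ≤ n)
  {x : Field.Carrier F} (gᵢ[x]≈0 : Field._≈_ F (g F n d i x) (Field.0# F))
  (a* : Addr d (n ∸ i)) (c₁ c₂ : Fin (d (n ∸ i))) (c₁≢c₂ : c₁ ≢ c₂)
  where

  open Field F hiding (zero)
  open import Algebra.Properties.Ring ring using (-1*x≈-x; -0#≈0#)
  open import Relation.Binary.Reasoning.Setoid setoid
  open Sums commutativeRing
  open FieldFacts F
  open BetheTree {n} {d}

  K : ℕ
  K = n ∸ i

  K<n : K < n
  K<n = n∸i<n {n} {i} 1≤n 1≤i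

  open Branch K K<n a*

  n∸K≡i : n ∸ K ≡ i
  n∸K≡i = m∸[m∸n]≡n i≤n

  G : ℕ → Carrier
  G j = g F n d j x

  weight : Maybe (Fin (d K)) → Carrier
  weight nothing  = 0#
  weight (just c) = δ c₁ c - δ c₂ c

  φ : Vertex n d → Carrier
  φ u = weight (branchᵛ u) * G (n ∸ level u)

  DefiningClauses : (Vertex n d → Carrier) → Set ℓ
  DefiningClauses f =
    (∀ w → InN w (v*-child c₁) → ∀ j → j < i → f (P^ j w) ≈ G j)
    × (∀ w → InN w (v*-child c₂) → ∀ j → j < i → f (P^ j w) ≈ - G j)
    × (∀ w → IsLeaf w → ¬ InN w (v*-child c₁) → ¬ InN w (v*-child c₂) →
         ∀ j → j < i → f (P^ j w) ≈ 0#)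
    × (∀ w → level w ≤ K → f w ≈ 0#)

  weight-c₁ : weight (just c₁) ≈ 1#
  weight-c₁ = begin
    δ c₁ c₁ - δ c₂ c₁  ≡⟨ ≡.cong₂ _-_ (δ-refl c₁) (δ-≢ c₁≢c₂) ⟩
    1# - 0#            ≈⟨ +-congˡ -0#≈0# ⟩
    1# + 0#            ≈⟨ +-identityʳ 1# ⟩
    1#                 ∎

  weight-c₂ : weight (just c₂) ≈ - 1#
  weight-c₂ = begin
    δ c₁ c₂ - δ c₂ c₂  ≡⟨ ≡.cong₂ _-_ (δ-≢ (c₁≢c₂ ∘ ≡.sym)) (δ-refl c₂) ⟩
    0# - 1#            ≈⟨ +-identityˡ (- 1#) ⟩
    - 1#               ∎

  weight-other : ∀ {c} → c ≢ c₁ → c ≢ c₂ → weight (just c) ≈ 0#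
  weight-other {c} c≢c₁ c≢c₂ = begin
    δ c₁ c - δ c₂ c  ≡⟨ ≡.cong₂ _-_ (δ-≢ c≢c₁) (δ-≢ c≢c₂) ⟩
    0# - 0#          ≈⟨ -‿inverseʳ 0# ⟩
    0#               ∎

  φ-below : ∀ u → level u ≤ K → φ u ≈ 0#
  φ-below u ≤K = trans (*-congʳ (reflexive (≡.cong weight (branch-≤ (level u) (addr u) ≤K)))) (zeroˡ _)

  φ-on-leaf-path : ∀ w j → IsLeaf w → j < i → φ (P^ j w) ≡ weight (branchᵛ w) * G j
  φ-on-leaf-path w j leaf j<i =
    ≡.cong₂ (λ b h → weight b * G h)
      (branch-P^ j w K<ℓ) (≡.trans (≡.cong (n ∸_) ℓ≡) (m∸[m∸n]≡n j≤n))
    where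
    j≤n = ≤-trans (<⇒≤ j<i) i≤n
    ℓ≡ : level (P^ j w) ≡ n ∸ j
    ℓ≡ = ≡.trans (level-P^ j w) (≡.cong (_∸ j) leaf)
    K<ℓ : K < level (P^ j w)
    K<ℓ = ≡.subst (K <_) (≡.sym ℓ≡) (∸-monoʳ-< j<i i≤n)

  leaf-weight-cases : ∀ w → IsLeaf w →
    (InN w (v*-child c₁) × weight (branchᵛ w) ≈ 1#)
    ⊎ (InN w (v*-child c₂) × weight (branchᵛ w) ≈ - 1#)
    ⊎ (¬ InN w (v*-child c₁) × ¬ InN w (v*-child c₂) × weight (branchᵛ w) ≈ 0#)
  leaf-weight-cases w leaf with branchᵛ w in b≡
  ... | nothing = inj₂ (inj₂ (not-in , not-in , refl))
    where
    not-in : ∀ {c} → ¬ InN w (v*-child c)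
    not-in inN with () ← ≡.trans (≡.sym b≡) (InN⇒branch inN)
  ... | just c = case ((c ≟ᶠ c₁) , (c ≟ᶠ c₂)) of λ where
      (yes ≡.refl , _)          → inj₁ (branch⇒InN leaf b≡ , weight-c₁)
      (no _       , yes ≡.refl) → inj₂ (inj₁ (branch⇒InN leaf b≡ , weight-c₂))
      (no c≢c₁    , no c≢c₂)    → inj₂ (inj₂ (not-in c≢c₁ , not-in c≢c₂ , weight-other c≢c₁ c≢c₂))
    where
    not-in : ∀ {c′} → c ≢ c′ → ¬ InN w (v*-child c′)
    not-in c≢c′ inN = c≢c′ (just-injective (≡.trans (≡.sym b≡) (InN⇒branch inN)))

  φ-DefiningClauses : DefiningClauses φ
  φ-DefiningClauses = on₁ , on₂ , off , φ-below
    where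
    on-leaf-path : ∀ {w} {b : Carrier} j → IsLeaf w → j < i → weight (branchᵛ w) ≈ b → φ (P^ j w) ≈ b * G j
    on-leaf-path {w} j leaf j<i w≈b = trans (reflexive (φ-on-leaf-path w j leaf j<i)) (*-congʳ w≈b)

    on₁ : ∀ w → InN w (v*-child c₁) → ∀ j → j < i → φ (P^ j w) ≈ G j
    on₁ w inN@(leaf , _) j j<i =
      trans (on-leaf-path j leaf j<i (trans (reflexive (≡.cong weight (InN⇒branch inN))) weight-c₁)) (*-identityˡ _)

    on₂ : ∀ w → InN w (v*-child c₂) → ∀ j → j < i → φ (P^ j w) ≈ - G j
    on₂ w inN@(leaf , _) j j<i =
      trans (on-leaf-path j leaf j<i (trans (reflexive (≡.cong weight (InN⇒branch inN))) weight-c₂)) (-1*x≈-x _)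

    off : ∀ w → IsLeaf w → ¬ InN w (v*-child c₁) → ¬ InN w (v*-child c₂) →
          ∀ j → j < i → φ (P^ j w) ≈ 0#
    off w leaf ∉₁ ∉₂ j j<i with leaf-weight-cases w leaf
    ... | inj₁ (∈₁ , _)              = contradiction ∈₁ ∉₁
    ... | inj₂ (inj₁ (∈₂ , _))       = contradiction ∈₂ ∉₂
    ... | inj₂ (inj₂ (_ , _ , w≈0)) = trans (on-leaf-path j leaf j<i w≈0) (zeroˡ _)

  clauses-on-leaf-paths : ∀ {f} → DefiningClauses f →
                          ∀ w → IsLeaf w → ∀ j → j < i → f (P^ j w) ≈ weight (branchᵛ w) * G j
  clauses-on-leaf-paths (on₁ , on₂ , off , _) w leaf j j<i with leaf-weight-cases w leaf
  ... | inj₁ (∈₁ , w≈1)              = trans (on₁ w ∈₁ j j<i) (sym (trans (*-congʳ w≈1) (*-identityˡ _)))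
  ... | inj₂ (inj₁ (∈₂ , w≈-1))      = trans (on₂ w ∈₂ j j<i) (sym (trans (*-congʳ w≈-1) (-1*x≈-x _)))
  ... | inj₂ (inj₂ (∉₁ , ∉₂ , w≈0)) = trans (off w leaf ∉₁ ∉₂ j j<i) (sym (trans (*-congʳ w≈0) (zeroˡ _)))

  clauses⇒≈φ : ∀ {f} → DefiningClauses f → ∀ u → f u ≈ φ u
  clauses⇒≈φ {f} clauses@(_ , _ , _ , below) u with level u ≤? K
  ... | yes ≤K = trans (below u ≤K) (sym (φ-below u ≤K))
  ... | no ≰K with leaf-descendant d>0 (n ∸ level u) u (m∸n+n≡m (bound u))
  ...   | w , leaf , Pʲw≡u = begin
    f u                      ≡⟨ ≡.cong f Pʲw≡u ⟨
    f (P^ j w)               ≈⟨ clauses-on-leaf-paths clauses w leaf j j<i ⟩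
    weight (branchᵛ w) * G j ≡⟨ φ-on-leaf-path w j leaf j<i ⟨
    φ (P^ j w)               ≡⟨ ≡.cong φ Pʲw≡u ⟩
    φ u                      ∎
    where
    j = n ∸ level u
    j<i : j < i
    j<i = ≡.subst (j <_) n∸K≡i (∸-monoʳ-< (≰⇒> ≰K) (bound u))

  sum-weight-children : ∀ m a →
    sum (map (λ c → weight (branch (suc m) (a , c))) (allFin (d m))) ≈ ι F (d m) * weight (branch m a)
  sum-weight-children m a = case (m ≟ K) of λ where
      (no m≢K) → begin
        sum (map (λ c → weight (branch (suc m) (a , c))) (allFin (d m)))
          ≈⟨ sum-map-cong (λ c → reflexive (≡.cong weight (branch-suc a c m≢K))) (allFin (d m)) ⟩
        sum (map (λ _ → weight (branch m a)) (allFin (d m)))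
          ≈⟨ sum-replicate _ (allFin (d m)) ⟩
        ι F (length (allFin (d m))) * weight (branch m a)
          ≡⟨ ≡.cong (λ k → ι F k * weight (branch m a)) (length-tabulate {n = d m} id) ⟩
        ι F (d m) * weight (branch m a) ∎
      (yes ≡.refl) → begin
        sum (map (λ c → weight (branch (suc K) (a , c))) (allFin (d K)))
          ≈⟨ at-level-K (a ≟ᴬ a*) ⟩
        0#
          ≈⟨ zeroʳ _ ⟨
        ι F (d K) * 0#
          ≡⟨ ≡.cong (λ b → ι F (d K) * weight b) (branch-≤ K a ≤-refl) ⟨
        ι F (d K) * weight (branch K a) ∎
    where
    at-level-K : ∀ {a} → Dec (a ≡ a*) → sum (map (λ c → weight (branch (suc K) (a , c))) (allFin (d K))) ≈ 0#
    at-level-K (no a≢a*) = sum-map-zero (λ c → reflexive (≡.cong weight (branch-off-v* c a≢a*))) (allFin (d K))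
    at-level-K (yes ≡.refl) = begin
      sum (map (λ c → weight (branch (suc K) (a* , c))) (allFin (d K)))
        ≈⟨ sum-map-cong (λ c → reflexive (≡.cong weight (branch-v*-child c))) (allFin (d K)) ⟩
      sum (map (λ c → δ c₁ c - δ c₂ c) (allFin (d K)))
        ≈⟨ sum-map-− (δ c₁) (δ c₂) (allFin (d K)) ⟩
      sum (map (δ c₁) (allFin (d K))) - sum (map (δ c₂) (allFin (d K)))
        ≈⟨ +-cong (sum-δ c₁) (-‿cong (sum-δ c₂)) ⟩
      1# - 1#
        ≈⟨ -‿inverseʳ 1# ⟩
      0# ∎

  sum-weight-level : ∀ m → sum (map (λ a → weight (branch m a)) (addrs d m)) ≈ 0#
  sum-weight-level zero    = +-identityˡ 0#
  sum-weight-level (suc m) = begin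
    sum (map wₛ (concatMap (λ a → map (a ,_) (allFin (d m))) (addrs d m)))
      ≈⟨ sum-map-concatMap wₛ _ (addrs d m) ⟩
    sum (map (λ a → sum (map wₛ (map (a ,_) (allFin (d m))))) (addrs d m))
      ≡⟨ ≡.cong sum (map-cong (λ a → ≡.cong sum (map-∘ (allFin (d m)))) (addrs d m)) ⟨
    sum (map (λ a → sum (map (λ c → wₛ (a , c)) (allFin (d m)))) (addrs d m))
      ≈⟨ sum-map-cong (sum-weight-children m) (addrs d m) ⟩
    sum (map (λ a → ι F (d m) * weight (branch m a)) (addrs d m))
      ≈⟨ sum-map-*ˡ (ι F (d m)) _ (addrs d m) ⟩
    ι F (d m) * sum (map (λ a → weight (branch m a)) (addrs d m))
      ≈⟨ *-congˡ (sum-weight-level m) ⟩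
    ι F (d m) * 0#
      ≈⟨ zeroʳ _ ⟩
    0# ∎
    where
    wₛ : Addr d (suc m) → Carrier
    wₛ = weight ∘ branch (suc m)

  φ-InAperp : InAperp F φ
  φ-InAperp m p = begin
    sum (map (λ a → weight (branch m a) * G (n ∸ m)) (addrs d m))  ≈⟨ sum-map-*ʳ _ (G (n ∸ m)) (addrs d m) ⟩
    sum (map (λ a → weight (branch m a)) (addrs d m)) * G (n ∸ m)  ≈⟨ *-congʳ (sum-weight-level m) ⟩
    0# * G (n ∸ m)                                                 ≈⟨ zeroˡ _ ⟩
    0#                                                             ∎

  g-recurrence : ∀ ℓ → ℓ ≤ n →
    G (suc (n ∸ ℓ)) ≈ (ι F (d ℓ) + 1#) * x * G (n ∸ ℓ) - ι F (d ℓ) * G (n ∸ suc ℓ)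
  g-recurrence ℓ ℓ≤n with m≤n⇒m<n∨m≡n ℓ≤n
  ... | inj₁ ℓ<n = begin
    G (suc (n ∸ ℓ))
      ≡⟨ ≡.cong (G ∘ suc) (n∸m≡suc[n∸suc[m]] ℓ<n) ⟩
    (ι F (d (n ∸ suc h)) + 1#) * x * G (suc h) - ι F (d (n ∸ suc h)) * G h
      ≡⟨ ≡.cong (λ k → (ι F (d k) + 1#) * x * G (suc h) - ι F (d k) * G h) n∸suc[h]≡ℓ ⟩
    (ι F (d ℓ) + 1#) * x * G (suc h) - ι F (d ℓ) * G h
      ≡⟨ ≡.cong (λ k → (ι F (d ℓ) + 1#) * x * G k - ι F (d ℓ) * G h) (n∸m≡suc[n∸suc[m]] ℓ<n) ⟨
    (ι F (d ℓ) + 1#) * x * G (n ∸ ℓ) - ι F (d ℓ) * G h ∎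
    where
    h = n ∸ suc ℓ
    n∸suc[h]≡ℓ : n ∸ suc h ≡ ℓ
    n∸suc[h]≡ℓ = ≡.trans (≡.cong (n ∸_) (≡.sym (n∸m≡suc[n∸suc[m]] ℓ<n))) (m∸[m∸n]≡n ℓ≤n)
  ... | inj₂ ≡.refl
    rewrite n∸n≡0 n | m≤n⇒m∸n≡0 (n≤1+n n) | dn≡0 = begin
    x                                ≈⟨ *-identityˡ x ⟨
    1# * x                           ≈⟨ *-congʳ (+-identityˡ 1#) ⟨
    (0# + 1#) * x                    ≈⟨ *-identityʳ _ ⟨
    (0# + 1#) * x * 1#               ≈⟨ +-identityʳ _ ⟨
    (0# + 1#) * x * 1# + 0#          ≈⟨ +-congˡ (trans (-‿cong (zeroˡ 1#)) -0#≈0#) ⟨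
    (0# + 1#) * x * 1# - 0# * 1#     ∎

  φ-parent : ∀ m (p : suc m ≤ n) a c →
             φ (P (vtx (suc m) p (a , c))) ≈ weight (branch (suc m) (a , c)) * G (n ∸ m)
  φ-parent m p a c = case (m ≟ K) of λ where
      (no m≢K)     → reflexive (≡.cong (λ b → weight b * G (n ∸ m)) (≡.sym (branch-suc a c m≢K)))
      (yes ≡.refl) → trans (vanishes _) (sym (vanishes _))
    where
    G[n∸K]≈0 : G (n ∸ K) ≈ 0#
    G[n∸K]≈0 = trans (reflexive (≡.cong G n∸K≡i)) gᵢ[x]≈0
    vanishes : ∀ y → y * G (n ∸ K) ≈ 0#
    vanishes y = trans (*-congˡ G[n∸K]≈0) (zeroʳ y)

  sum-φ-children : ∀ u →
    sum (map φ (children u)) ≈ ι F (d (level u)) * (weight (branchᵛ u) * G (n ∸ suc (level u)))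
  sum-φ-children u@(vtx m p a) with m≤n⇒m<n∨m≡n p
  ... | inj₁ m<n = begin
    sum (map φ (children u))
      ≡⟨ ≡.cong (sum ∘ map φ) (children-< u m<n) ⟩
    sum (map φ (map (λ c → vtx (suc m) m<n (a , c)) (allFin (d m))))
      ≡⟨ ≡.cong sum (map-∘ (allFin (d m))) ⟨
    sum (map (λ c → weight (branch (suc m) (a , c)) * G (n ∸ suc m)) (allFin (d m)))
      ≈⟨ sum-map-*ʳ _ _ (allFin (d m)) ⟩
    sum (map (λ c → weight (branch (suc m) (a , c))) (allFin (d m))) * G (n ∸ suc m)
      ≈⟨ *-congʳ (sum-weight-children m a) ⟩
    ι F (d m) * weight (branch m a) * G (n ∸ suc m)
      ≈⟨ *-assoc _ _ _ ⟩
    ι F (d m) * (weight (branch m a) * G (n ∸ suc m)) ∎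
  ... | inj₂ leaf = begin
    sum (map φ (children u))  ≡⟨ ≡.cong (sum ∘ map φ) (children-leaf u leaf) ⟩
    0#                        ≈⟨ zeroˡ _ ⟨
    0# * tail                 ≡⟨ ≡.cong (λ k → ι F k * tail) (≡.trans (≡.cong d leaf) dn≡0) ⟨
    ι F (d m) * tail          ∎
    where
    tail = weight (branch m a) * G (n ∸ suc m)

  φ-neighbour-sum : ∀ u → sum (map φ (neighbours u)) ≈ ι F (deg u) * (x * φ u)
  φ-neighbour-sum u@(vtx zero p a) = begin
    sum (map φ (children u))                 ≈⟨ sum-φ-children u ⟩
    ι F (d 0) * (0# * G (n ∸ 1))             ≈⟨ trans (*-congˡ (zeroˡ _)) (zeroʳ _) ⟩
    0#                                       ≈⟨ zeroʳ _ ⟨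
    ι F (deg u) * 0#                         ≈⟨ *-congˡ (trans (*-congˡ (φ-below u z≤n)) (zeroʳ x)) ⟨
    ι F (deg u) * (x * φ u)                  ∎
  φ-neighbour-sum u@(vtx (suc m) p (a , c)) = begin
    φ (P u) + sum (map φ (children u))
      ≈⟨ +-cong (φ-parent m p a c) (sum-φ-children u) ⟩
    wᵤ * G (n ∸ m) + D * (wᵤ * G (n ∸ suc (suc m)))
      ≡⟨ ≡.cong (λ h → wᵤ * G h + D * (wᵤ * G (n ∸ suc (suc m)))) (n∸m≡suc[n∸suc[m]] p) ⟩
    wᵤ * G (suc (n ∸ suc m)) + D * (wᵤ * G (n ∸ suc (suc m)))
      ≈⟨ recurrence⇒local-eigen-equation commutativeRing D x wᵤ _ _ _ (g-recurrence (suc m) p) ⟩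
    (1# + D) * (x * (wᵤ * G (n ∸ suc m)))
      ≡⟨ ≡.cong (λ k → ι F (suc k) * (x * φ u)) (length-children dn≡0 u) ⟨
    ι F (deg u) * (x * φ u) ∎
    where
    wᵤ = weight (branchᵛ u)
    D = ι F (d (suc m))

  deg-pos : ∀ (u : Vertex n d) → 0 < deg u
  deg-pos u@(vtx zero _ _) = ≡.subst (0 <_) (≡.sym (length-children dn≡0 u)) (d>0 0 1≤n)
  deg-pos (vtx (suc _) _ _) = s≤s z≤n

  φ-eigen : ∀ u → T F φ u ≈ x * φ u
  φ-eigen u = T-eigen φ x u (ι-nonzero charZero (deg-pos u)) (φ-neighbour-sum u)

  clauses⇒eigenvector : ∀ f → DefiningClauses f →
    (∃ λ u → ¬ f u ≈ 0#) × InAperp F f × (∀ u → T F f u ≈ x * f u)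
  clauses⇒eigenvector f clauses@(on₁ , _) = nonzero , InAperp-cong f≈φ φ-InAperp , eigen
    where
    f≈φ = clauses⇒≈φ clauses
    nonzero : ∃ λ u → ¬ f u ≈ 0#
    nonzero with leaf-descendant d>0 (n ∸ suc K) (v*-child c₁) (m∸n+n≡m K<n)
    ... | w , leaf , Pʲw≡ = w , λ fw≈0 → 0≉1 (trans (sym fw≈0) (on₁ w (leaf , n ∸ suc K , Pʲw≡) 0 1≤i))
    eigen : ∀ u → T F f u ≈ x * f u
    eigen u = begin
      T F f u   ≈⟨ T-cong f≈φ u ⟩
      T F φ u   ≈⟨ φ-eigen u ⟩
      x * φ u   ≈⟨ *-congˡ (f≈φ u) ⟨
      x * f u   ∎

lemma2p6 :
  ∀ {c ℓ : Level} (F : Field c ℓ) → CharZero F →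
  let open Field F in
  (n : ℕ) (1≤n : 1 ≤ n) →
  (d : ℕ → ℕ) → (∀ k → k < n → 1 ≤ d k) → d n ≡ 0 →
  -- i ∈ Ω
  (i : ℕ) (1≤i : 1 ≤ i) → i ≤ n → 2 ≤ d (n ∸ i) →
  -- λ a root of g_i
  (x : Carrier) → g F n d i x ≈ 0# →
  -- v* ∈ C_{n-i} and two distinct children v₁ , v₂ of v*
  (a* : Addr d (n ∸ i)) (c₁ c₂ : Fin (d (n ∸ i))) → c₁ ≢ c₂ →
  let v* : Vertex n d
      v* = atLevel∸ i a*
      v₁ = child v* (n∸i<n {n} {i} 1≤n 1≤i) c₁
      v₂ = child v* (n∸i<n {n} {i} 1≤n 1≤i) c₂
      DefiningClauses : (Vertex n d → Carrier) → Set _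
      DefiningClauses f =
        (∀ w → InN w v₁ → ∀ j → j < i → f (P^ j w) ≈ g F n d j x)
        × (∀ w → InN w v₂ → ∀ j → j < i → f (P^ j w) ≈ - g F n d j x)
        × (∀ w → IsLeaf w → ¬ InN w v₁ → ¬ InN w v₂ →
             ∀ j → j < i → f (P^ j w) ≈ 0#)
        × (∀ w → level w ≤ n ∸ i → f w ≈ 0#)
  in
  -- such an f exists, and every such f is a nonzero vector of 𝒜^⊥ with T f = λ f
  (Σ (Vertex n d → Carrier) DefiningClauses)
  × (∀ (f : Vertex n d → Carrier) → DefiningClauses f →
       (∃ λ u → ¬ (f u ≈ 0#))
       × InAperp F f
       × (∀ u → T F f u ≈ x * f u))
-- The hypothesis 2 ≤ d (n ∸ i) is implied by c₁ ≢ c₂.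
lemma2p6 F charZero n 1≤n d d>0 dn≡0 i 1≤i i≤n _ x gᵢ[x]≈0 a* c₁ c₂ c₁≢c₂ =
  (φ , φ-DefiningClauses) , clauses⇒eigenvector
  where open Eigenvector F charZero 1≤n d>0 dn≡0 1≤i i≤n gᵢ[x]≈0 a* c₁ c₂ c₁≢c₂
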